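{- Let $n\ge 2$, $k\ge1$, $t\ge1$ be integers such that $P_n^{(k)}$ is $t$-wide, let $d$ be the diameter of $P_n^{(k)}$, and let $D$ be a target distribution on $P_n^{(k)}$ of size $t$. If $d\ge 2$ then $s(D)<n$. Equivalently, if $s(D)=n$ then $d=1$, i.e., $P_n^{(k)}=K_n$.
   Context: $P_n^{(k)}$ has vertices $v_1,\dots,v_n$ with $v_i\sim v_j$ iff $1\le|i-j|\le k$; its diameter is $d=\lfloor (n-2)/k\rfloor+1$. Set $t_0=1$ if $d=1$ and $t_0=k(d-1)/(2^d-2)$ if $d\ge2$; $P_n^{(k)}$ is $t$-wide if $t\le t_0$. A target distribution is $D:V\to\mathbb{N}$ with size $\sum_vD(v)$, and $s(D)=|\{v:D(v)>0\}|$. -}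

module Defs where

open import Data.Nat using (ℕ; zero; suc; _+_; _*_; _∸_; _^_; _≤_; _<_; NonZero)
open import Data.Nat.DivMod using (_/_)
open import Data.Fin using (Fin)
open import Data.List using (List; length; filter; map; allFin)
open import Data.Nat.ListAction using (sum)
open import Data.Nat using (_>?_)

-- Diameter of P_n^(k) (vertices v_1..v_n, v_i ~ v_j iff 1 ≤ |i-j| ≤ k),
-- as given in the paper: d = ⌊(n-2)/k⌋ + 1 (for n ≥ 2, k ≥ 1).
diam : (n k : ℕ) → .{{NonZero k}} → ℕ
diam n k = (n ∸ 2) / k + 1

-- t-wide: t ≤ t₀ where t₀ = 1 if d = 1 and t₀ = k(d-1)/(2^d-2) if d ≥ 2.
-- For d ≥ 2, 2^d - 2 > 0, so t ≤ k(d-1)/(2^d-2) iff t(2^d-2) ≤ k(d-1).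
Wide : (n k : ℕ) → .{{NonZero k}} → ℕ → Set
Wide n k t with diam n k
... | zero = t ≤ 1
... | suc zero = t ≤ 1
... | d@(suc (suc _)) = t * (2 ^ d ∸ 2) ≤ k * (d ∸ 1)

TargetDist : ℕ → Set
TargetDist n = Fin n → ℕ

size : {n : ℕ} → TargetDist n → ℕ
size {n} D = sum (map D (allFin n))

supp : {n : ℕ} → TargetDist n → ℕ
supp {n} D = length (filter (λ v → D v >? 0) (allFin n))

{-# OPTIONS --safe #-}
-- Every vertex in the support carries at least one pebble, so s(D) ≤ t. Width gives
-- t ≤ t(2^d − 2) ≤ k(d − 1), and k(d − 1) = k⌊(n − 2)/k⌋ ≤ n − 2 < n.
module Submission where

open import Defs
open import Data.Nat using (ℕ; suc; _+_; _*_; _∸_; _^_; _≤_; _<_; NonZero; z≤n; s≤s; z<s; _>?_; >-nonZero)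
open import Data.Nat.Properties
open import Data.Nat.DivMod using (_/_; m/n*n≤m)
open import Data.List using (List; []; _∷_; length; filter; map; allFin)
open import Data.List.Properties using (filter-accept; filter-reject)
open import Data.Nat.ListAction using (sum)
open import Relation.Nullary using (yes; no)
open import Relation.Binary.PropositionalEquality using (_≡_; cong)

length-filter-positive≤sum : {A : Set} (f : A → ℕ) (xs : List A) →
  length (filter (λ x → f x >? 0) xs) ≤ sum (map f xs)
length-filter-positive≤sum f [] = z≤n
length-filter-positive≤sum f (x ∷ xs) with f x >? 0
... | yes fx>0 rewrite filter-accept (λ y → f y >? 0) {x} {xs} fx>0 =
  +-mono-≤ fx>0 (length-filter-positive≤sum f xs)
... | no fx≯0 rewrite filter-reject (λ y → f y >? 0) {x} {xs} fx≯0 =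
  ≤-trans (length-filter-positive≤sum f xs) (m≤n+m _ (f x))

supp≤size : {n : ℕ} (D : TargetDist n) → supp D ≤ size D
supp≤size {n} D = length-filter-positive≤sum D (allFin n)

1≤2^[2+m]∸2 : ∀ m → 1 ≤ 2 ^ (2 + m) ∸ 2
1≤2^[2+m]∸2 m = ≤-trans (s≤s z≤n) (∸-monoˡ-≤ 2 (^-monoʳ-≤ 2 {2} {2 + m} (m≤m+n 2 m)))

wide⇒t≤k*[diam∸1] : ∀ n k t → .{{_ : NonZero k}} → Wide n k t → 2 ≤ diam n k →
  t ≤ k * (diam n k ∸ 1)
wide⇒t≤k*[diam∸1] n k t wide 2≤d with diam n k
wide⇒t≤k*[diam∸1] n k t wide (s≤s (s≤s _)) | suc (suc m) = ≤-trans (m≤m*n t (2 ^ (2 + m) ∸ 2)) wide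
  where instance
    2^d∸2-nonZero : NonZero (2 ^ (2 + m) ∸ 2)
    2^d∸2-nonZero = >-nonZero (1≤2^[2+m]∸2 m)

k*[diam∸1]≤n∸2 : ∀ n k → .{{_ : NonZero k}} → k * (diam n k ∸ 1) ≤ n ∸ 2
k*[diam∸1]≤n∸2 n k = begin
  k * (diam n k ∸ 1)   ≡⟨ cong (k *_) (m+n∸n≡m ((n ∸ 2) / k) 1) ⟩
  k * ((n ∸ 2) / k)    ≡⟨ *-comm k _ ⟩
  (n ∸ 2) / k * k      ≤⟨ m/n*n≤m (n ∸ 2) k ⟩
  n ∸ 2                ∎
  where open ≤-Reasoning

fact29 : (n k t : ℕ) → .{{_ : NonZero k}} → 2 ≤ n → 1 ≤ t → Wide n k t →
    (D : TargetDist n) → size D ≡ t →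
    2 ≤ diam n k → supp D < n
fact29 n k t 2≤n _ wide D size≡t 2≤d = begin-strict
  supp D              ≤⟨ supp≤size D ⟩
  size D              ≡⟨ size≡t ⟩
  t                   ≤⟨ wide⇒t≤k*[diam∸1] n k t wide 2≤d ⟩
  k * (diam n k ∸ 1)  ≤⟨ k*[diam∸1]≤n∸2 n k ⟩
  n ∸ 2               <⟨ ∸-monoʳ-< {o = 0} z<s 2≤n ⟩
  n                   ∎
  where open ≤-Reasoning
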